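{- A string $Z$ is almost square-free if and only if there exist a square-free string $Z_{SF}$ and a set $I\subseteq[|Z_{SF}|]$ such that $Z=dup(Z_{SF},I)$. Moreover, if $Z$ is almost square-free, then the only contractions possible on $Z$ are of size $1$, i.e., those that remove one of two consecutive equal characters.
   Context: A square is a string of the form $XX$ with $X$ nonempty; a string is square-free if it has no square as a (contiguous) substring. $S'\subseteq S$ means $S'$ is a subsequence of $S$. For a string $A=a_1\cdots a_n$ and a set $I=\{i_1<\dots<i_k\}\subseteq[n]$, $dup(A,I)$ is the string obtained from $A$ by replacing each character $a_{i_j}$ ($j=1,\dots,k$) by $a_{i_j}a_{i_j}$; and $S^{dup}=dup(S,[|S|])$ is $S$ with every character doubled. A string $S$ is almost square-free if there is a square-free string $S_{SF}$ with $S_{SF}\subseteq S\subseteq S_{SF}^{dup}$. A contraction replaces a substring $XX$ ($X$ nonempty) of a string $AXXB$ by $X$, yielding $AXB$; its size is $|X|$. -}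

module Defs where

open import Data.List using (List; []; _∷_; _++_; length)
open import Data.List.Relation.Binary.Sublist.Propositional using (_⊆_)
open import Data.Vec using (Vec; []; _∷_)
open import Data.Fin.Subset using (Subset; Side; inside; outside)
open import Data.Product using (∃; ∃-syntax; Σ-syntax; _×_)
open import Relation.Binary.PropositionalEquality using (_≡_; _≢_)
open import Relation.Nullary using (¬_)

SquareFree : ∀ {a} {A : Set a} → List A → Set a
SquareFree S = ∀ P X Q → X ≢ [] → S ≢ P ++ (X ++ (X ++ Q))

-- dup(S, I), I ⊆ [|S|] represented as a Subset of Fin (length S):
-- position j is doubled iff it is inside I.
dup : ∀ {a} {A : Set a} (S : List A) → Subset (length S) → List A
dup []      []            = []
dup (x ∷ S) (inside ∷ I)  = x ∷ x ∷ dup S I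
dup (x ∷ S) (outside ∷ I) = x ∷ dup S I

dupAll : ∀ {a} {A : Set a} → List A → List A
dupAll []      = []
dupAll (x ∷ S) = x ∷ x ∷ dupAll S

AlmostSquareFree : ∀ {a} {A : Set a} → List A → Set a
AlmostSquareFree S = ∃[ SF ] (SquareFree SF × SF ⊆ S × S ⊆ dupAll SF)

-- A contraction on Z: Z = P ++ X ++ X ++ Q with X nonempty, replaced by
-- P ++ X ++ Q; its size is |X|. A "possible contraction on Z" is such a
-- decomposition of Z.
ContractionSite : ∀ {a} {A : Set a} → List A → List A → List A → List A → Set a
ContractionSite Z P X Q = X ≢ [] × Z ≡ P ++ (X ++ (X ++ Q))

module Submission where

-- We work with the relation  Inflation S Z  ("Z is S with some letters
-- doubled"), the inductive counterpart of dup, and with  SubInflation S Z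
-- ("Z is S with every letter kept 0, 1 or 2 times"), the inductive
-- counterpart of Z ⊆ S^dup.  The only property of square-freeness used for
-- the structure theory is that adjacent letters differ.
--
-- Part 1: if S has distinct adjacent letters, S ⊆ Z and Z is a
-- sub-inflation of S, then no letter of S is omitted in Z (an embedding of
-- an adjacent-distinct list into a sub-inflation of S is no longer than S),
-- so Z is an inflation of S.
--
-- Part 2: a factor of an inflation of S is an inflation of a factor of S.
-- Splitting an inflation of a square-free T at the middle of XX, and using
-- that inflation is injective on adjacent-distinct lists, produces a square
-- in T unless X is a single letter.

open import Defs
open import Data.List using (List; []; _∷_; _++_; [_]; length)
open import Data.List.Properties using (++-assoc; ++-identityʳ)
open import Data.List.Relation.Binary.Sublist.Heterogeneous using ([]; _∷_; _∷ʳ_; minimum)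
open import Data.List.Relation.Binary.Sublist.Heterogeneous.Properties using (∷⁻; length-mono-≤)
open import Data.List.Relation.Binary.Sublist.Propositional using (_⊆_)
open import Data.List.Relation.Unary.Linked as Linked using (Linked; []; [-]; _∷_)
open import Data.Nat using (_≤_; s≤s)
open import Data.Nat.Properties using (m≤n⇒m≤1+n; 1+n≰n)
open import Data.Vec using ([]; _∷_)
open import Data.Fin.Subset using (Subset; inside; outside)
open import Data.Product using (∃-syntax; _×_; _,_)
open import Data.Empty using (⊥-elim)
open import Relation.Binary.PropositionalEquality using (_≡_; _≢_; refl; sym; trans; cong; subst)
open import Function.Bundles using (_⇔_; mk⇔)

module _ {a} {A : Set a} where

  private
    variable
      x y : A
      S S₁ S₂ T U V W Z : List A

  AdjacentDistinct : List A → Set a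
  AdjacentDistinct = Linked _≢_

  squareFree-suffix : ∀ S₁ → SquareFree (S₁ ++ S₂) → SquareFree S₂
  squareFree-suffix S₁ sf P X Q X≢[] eq =
    sf (S₁ ++ P) X Q X≢[] (trans (cong (S₁ ++_) eq) (sym (++-assoc S₁ P _)))

  squareFree-prefix : ∀ S₂ → SquareFree (S₁ ++ S₂) → SquareFree S₁
  squareFree-prefix S₂ sf P X Q X≢[] eq =
    sf P X (Q ++ S₂) X≢[]
      (trans (cong (_++ S₂) eq)
      (trans (++-assoc P _ S₂)
      (cong (P ++_) (trans (++-assoc X _ S₂) (cong (X ++_) (++-assoc X Q S₂))))))

  squareFree-infix : ∀ S₁ S₂ → SquareFree (S₁ ++ T ++ S₂) → SquareFree T
  squareFree-infix S₁ S₂ sf = squareFree-prefix S₂ (squareFree-suffix S₁ sf)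

  squareFree⇒adjacentDistinct : ∀ S → SquareFree S → AdjacentDistinct S
  squareFree⇒adjacentDistinct []          sf = []
  squareFree⇒adjacentDistinct (x ∷ [])    sf = [-]
  squareFree⇒adjacentDistinct (x ∷ y ∷ S) sf =
    (λ { refl → sf [] [ x ] S (λ ()) refl })
    ∷ squareFree⇒adjacentDistinct (y ∷ S) (squareFree-suffix [ x ] sf)

  data Inflation : List A → List A → Set a where
    nil : Inflation [] []
    one : Inflation S Z → Inflation (x ∷ S) (x ∷ Z)
    two : Inflation S Z → Inflation (x ∷ S) (x ∷ x ∷ Z)

  inflation-dup : ∀ S (I : Subset (length S)) → Inflation S (dup S I)
  inflation-dup []      []            = nil
  inflation-dup (x ∷ S) (inside ∷ I)  = two (inflation-dup S I)
  inflation-dup (x ∷ S) (outside ∷ I) = one (inflation-dup S I)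

  dup-inflation : Inflation S Z → ∃[ I ] (Z ≡ dup S I)
  dup-inflation nil = [] , refl
  dup-inflation (one d) with dup-inflation d
  ... | I , refl = outside ∷ I , refl
  dup-inflation (two d) with dup-inflation d
  ... | I , refl = inside ∷ I , refl

  inflation-⊇ : Inflation S Z → S ⊆ Z
  inflation-⊇ nil     = []
  inflation-⊇ (one d) = refl ∷ inflation-⊇ d
  inflation-⊇ (two d) = refl ∷ (_ ∷ʳ inflation-⊇ d)

  inflation-⊆dupAll : Inflation S Z → Z ⊆ dupAll S
  inflation-⊆dupAll nil     = []
  inflation-⊆dupAll (one d) = refl ∷ (_ ∷ʳ inflation-⊆dupAll d)
  inflation-⊆dupAll (two d) = refl ∷ (refl ∷ inflation-⊆dupAll d)

  data SubInflation : List A → List A → Set a where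
    nil  : SubInflation [] []
    skip : SubInflation S Z → SubInflation (x ∷ S) Z
    one  : SubInflation S Z → SubInflation (x ∷ S) (x ∷ Z)
    two  : SubInflation S Z → SubInflation (x ∷ S) (x ∷ x ∷ Z)

  ⊆dupAll⇒subInflation : ∀ S → Z ⊆ dupAll S → SubInflation S Z
  ⊆dupAll⇒subInflation []      []                   = nil
  ⊆dupAll⇒subInflation (x ∷ S) (_ ∷ʳ (_ ∷ʳ p))      = skip (⊆dupAll⇒subInflation S p)
  ⊆dupAll⇒subInflation (x ∷ S) (_ ∷ʳ (refl ∷ p))    = one (⊆dupAll⇒subInflation S p)
  ⊆dupAll⇒subInflation (x ∷ S) (refl ∷ (_ ∷ʳ p))    = one (⊆dupAll⇒subInflation S p)
  ⊆dupAll⇒subInflation (x ∷ S) (refl ∷ (refl ∷ p))  = two (⊆dupAll⇒subInflation S p)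

  ⊆-skip-repeat : AdjacentDistinct (x ∷ T) → T ⊆ (x ∷ Z) → T ⊆ Z
  ⊆-skip-repeat {T = []}    ad p          = minimum _
  ⊆-skip-repeat {T = _ ∷ _} ad (_ ∷ʳ p)   = p
  ⊆-skip-repeat {T = _ ∷ _} ad (refl ∷ p) = ⊥-elim (Linked.head ad refl)

  -- An adjacent-distinct list embeds into a sub-inflation of S only if it
  -- is no longer than S: two consecutive letters never meet one block xx.
  embedding-length : AdjacentDistinct T → SubInflation S Z → T ⊆ Z → length T ≤ length S
  embedding-length ad nil       p          = length-mono-≤ p
  embedding-length ad (skip r)  p          = m≤n⇒m≤1+n (embedding-length ad r p)
  embedding-length ad (one r)   (_ ∷ʳ p)   = m≤n⇒m≤1+n (embedding-length ad r p)
  embedding-length ad (one r)   (refl ∷ p) = s≤s (embedding-length (Linked.tail ad) r p)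
  embedding-length ad (two r)   (_ ∷ʳ p)   = embedding-length ad (one r) p
  embedding-length ad (two r)   (refl ∷ p) =
    s≤s (embedding-length (Linked.tail ad) r (⊆-skip-repeat ad p))

  -- The sandwich S ⊆ Z ⊆ S^dup forces Z to be an inflation of S when S has
  -- distinct adjacent letters: by embedding-length no letter can be omitted.
  sandwich-inflation : AdjacentDistinct S → S ⊆ Z → SubInflation S Z → Inflation S Z
  sandwich-inflation ad p nil      = nil
  sandwich-inflation ad p (skip r) = ⊥-elim (1+n≰n (embedding-length ad r p))
  sandwich-inflation ad p (one r)  = one (sandwich-inflation (Linked.tail ad) (∷⁻ p) r)
  sandwich-inflation ad p (two r)  =
    two (sandwich-inflation (Linked.tail ad) (⊆-skip-repeat ad (∷⁻ p)) r)

  almostSquareFree⇒dup : AlmostSquareFree Z → ∃[ SF ] ∃[ I ] (SquareFree SF × Z ≡ dup SF I)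
  almostSquareFree⇒dup (SF , sf , SF⊆Z , Z⊆SFᵈᵘᵖ)
    with dup-inflation (sandwich-inflation (squareFree⇒adjacentDistinct SF sf) SF⊆Z
                                           (⊆dupAll⇒subInflation SF Z⊆SFᵈᵘᵖ))
  ... | I , Z≡ = SF , I , sf , Z≡

  dup⇒almostSquareFree : ∃[ SF ] ∃[ I ] (SquareFree SF × Z ≡ dup SF I) → AlmostSquareFree Z
  dup⇒almostSquareFree (SF , I , sf , refl) =
    SF , sf , inflation-⊇ (inflation-dup SF I) , inflation-⊆dupAll (inflation-dup SF I)

  inflation-[] : Inflation [] Z → Z ≡ []
  inflation-[] nil = refl

  inflation-snoc : Inflation S U → Inflation (S ++ [ y ]) (U ++ [ y ])
  inflation-snoc nil     = one nil
  inflation-snoc (one d) = one (inflation-snoc d)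
  inflation-snoc (two d) = two (inflation-snoc d)

  -- On adjacent-distinct lists, inflation is injective: the runs of Z
  -- determine S.
  inflation-injective : AdjacentDistinct S₁ → AdjacentDistinct S₂ →
                        Inflation S₁ Z → Inflation S₂ Z → S₁ ≡ S₂
  inflation-injective ad₁ ad₂ nil nil = refl
  inflation-injective ad₁ ad₂ (one d₁) (one d₂) =
    cong (_ ∷_) (inflation-injective (Linked.tail ad₁) (Linked.tail ad₂) d₁ d₂)
  inflation-injective ad₁ ad₂ (two d₁) (two d₂) =
    cong (_ ∷_) (inflation-injective (Linked.tail ad₁) (Linked.tail ad₂) d₁ d₂)
  inflation-injective ad₁ ad₂ (one (one d₁)) (two d₂) = ⊥-elim (Linked.head ad₁ refl)
  inflation-injective ad₁ ad₂ (one (two d₁)) (two d₂) = ⊥-elim (Linked.head ad₁ refl)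
  inflation-injective ad₁ ad₂ (two d₁) (one (one d₂)) = ⊥-elim (Linked.head ad₂ refl)
  inflation-injective ad₁ ad₂ (two d₁) (one (two d₂)) = ⊥-elim (Linked.head ad₂ refl)

  -- The two ways an inflation of S can be cut into U and V: between the
  -- images of two letters of S, or through the image yy of a doubled letter.
  data Cut (U V : List A) : List A → Set a where
    between : Inflation S₁ U → Inflation S₂ V → Cut U V (S₁ ++ S₂)
    through : ∀ U′ y V′ → U ≡ U′ ++ [ y ] → V ≡ y ∷ V′ →
              Inflation S₁ U′ → Inflation S₂ V′ → Cut U V (S₁ ++ y ∷ S₂)

  cut-one : Cut U V S → Cut (x ∷ U) V (x ∷ S)
  cut-one (between d₁ d₂)                 = between (one d₁) d₂
  cut-one (through U′ y V′ refl V≡ d₁ d₂) = through (_ ∷ U′) y V′ refl V≡ (one d₁) d₂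

  cut-two : Cut U V S → Cut (x ∷ x ∷ U) V (x ∷ S)
  cut-two (between d₁ d₂)                 = between (two d₁) d₂
  cut-two (through U′ y V′ refl V≡ d₁ d₂) = through (_ ∷ _ ∷ U′) y V′ refl V≡ (two d₁) d₂

  cut : ∀ U → Inflation S (U ++ V) → Cut U V S
  cut []                 d       = between nil d
  cut (u ∷ [])           (one d) = between (one nil) d
  cut (u ∷ [])           (two d) = through [] u _ refl refl nil d
  cut (u ∷ U@(_ ∷ _))    (one d) = cut-one (cut U d)
  cut (u ∷ .u ∷ U)       (two d) = cut-two (cut U d)

  inflation-suffix : ∀ P → Inflation S (P ++ W) → ∃[ S₁ ] ∃[ S₂ ] (S ≡ S₁ ++ S₂ × Inflation S₂ W)
  inflation-suffix P d with cut P d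
  ... | between {S₁} {S₂} d₁ d₂             = S₁ , S₂ , refl , d₂
  ... | through {S₁} {S₂} _ y _ _ refl _ d₂ = S₁ , y ∷ S₂ , refl , one d₂

  inflation-prefix : ∀ W → Inflation S (W ++ U) → ∃[ S₁ ] ∃[ S₂ ] (S ≡ S₁ ++ S₂ × Inflation S₁ W)
  inflation-prefix W d with cut W d
  ... | between {S₁} {S₂} d₁ d₂             = S₁ , S₂ , refl , d₁
  ... | through {S₁} {S₂} _ y _ refl _ d₁ _ =
    S₁ ++ [ y ] , S₂ , sym (++-assoc S₁ [ y ] S₂) , inflation-snoc d₁

  inflation-infix : ∀ P W Q → Inflation S (P ++ W ++ Q) →
                    ∃[ S₁ ] ∃[ T ] ∃[ S₂ ] (S ≡ S₁ ++ T ++ S₂ × Inflation T W)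
  inflation-infix P W Q d with inflation-suffix P d
  ... | S₁ , _ , refl , d′ with inflation-prefix W d′
  ... | T , S₂ , refl , d″ = S₁ , T , S₂ , refl , d″

  square-in-inflation : ∀ X → SquareFree T → Inflation T (X ++ X) → X ≢ [] → length X ≡ 1
  square-in-inflation X sf d X≢[] with cut X d
  ... | between {T₁} {T₂} d₁ d₂ = ⊥-elim (sf [] T₁ [] T₁≢[] T≡T₁T₁)
    where
      T₁≡T₂ : T₁ ≡ T₂
      T₁≡T₂ = inflation-injective
                (squareFree⇒adjacentDistinct T₁ (squareFree-prefix T₂ sf))
                (squareFree⇒adjacentDistinct T₂ (squareFree-suffix T₁ sf)) d₁ d₂
      T₁≢[] : T₁ ≢ []
      T₁≢[] refl = X≢[] (inflation-[] d₁)
      T≡T₁T₁ : T₁ ++ T₂ ≡ T₁ ++ T₁ ++ []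
      T≡T₁T₁ = cong (T₁ ++_) (trans (sym T₁≡T₂) (sym (++-identityʳ T₁)))
  ... | through {T₁} {T₂} U′ y V′ refl V≡ d₁ d₂ = single-letter T₁ sf T₁y≡yT₂ d₁
    where
      sf₁ : SquareFree (T₁ ++ [ y ])
      sf₁ = squareFree-prefix T₂ (subst SquareFree (sym (++-assoc T₁ [ y ] T₂)) sf)
      T₁y≡yT₂ : T₁ ++ [ y ] ≡ y ∷ T₂
      T₁y≡yT₂ = inflation-injective
                  (squareFree⇒adjacentDistinct _ sf₁)
                  (squareFree⇒adjacentDistinct _ (squareFree-suffix T₁ sf))
                  (inflation-snoc d₁) (subst (Inflation (y ∷ T₂)) (sym V≡) (one d₂))
      -- T₁ y = y T₂ means T₁ = [] (then X = y) or T = (y T′)(y T′) y.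
      single-letter : ∀ T₁ → SquareFree (T₁ ++ y ∷ T₂) → T₁ ++ [ y ] ≡ y ∷ T₂ →
                      Inflation T₁ U′ → length (U′ ++ [ y ]) ≡ 1
      single-letter []       _  _    nil = refl
      single-letter (_ ∷ T′) sf refl _   = ⊥-elim (sf [] (y ∷ T′) [ y ] (λ ()) refl)

  -- Part 2: a contraction site XX of Z sits inside an inflation of a
  -- factor of the square-free witness, so |X| = 1.
  almostSquareFree-contraction : AlmostSquareFree Z →
                                 ∀ P X Q → ContractionSite Z P X Q → length X ≡ 1
  almostSquareFree-contraction asf P X Q (X≢[] , Z≡) with almostSquareFree⇒dup asf
  ... | SF , I , sf , refl
    with inflation-infix P (X ++ X) Q
           (subst (Inflation SF) (trans Z≡ (cong (P ++_) (sym (++-assoc X X Q))))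
                  (inflation-dup SF I))
  ... | S₁ , T , S₂ , refl , d = square-in-inflation X (squareFree-infix S₁ S₂ sf) d X≢[]

lemma1 : ∀ {a} {A : Set a} (Z : List A) →
    (AlmostSquareFree Z ⇔ (∃[ SF ] ∃[ I ] (SquareFree SF × Z ≡ dup SF I)))
    × (AlmostSquareFree Z → ∀ P X Q → ContractionSite Z P X Q → length X ≡ 1)
lemma1 Z = mk⇔ almostSquareFree⇒dup dup⇒almostSquareFree , almostSquareFree-contraction
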